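{- Let $n\ge 3$ and let $C_n$ be the cycle on $n$ vertices. Then for every positive integer $r$, \[ \varkappa(C_n^r)=\begin{cases} r+1 & \text{if } r<\lfloor n/2\rfloor,\\ n & \text{if } r\ge \lfloor n/2\rfloor.\end{cases} \]
   Context: All graphs are finite and simple. For a positive integer $r$, the $r$-th power $G^r$ of a graph $G$ has the same vertex set as $G$, two distinct vertices being adjacent in $G^r$ if and only if their distance in $G$ is at most $r$. For $A,B\subseteq\mathbb{N}_0$ the sumset is $A+B=\{a+b:a\in A,b\in B\}$, and the difference set $D_A$ of $A$ is the set of differences of pairs of elements of $A$. An integer additive set-indexer (IASI) of $G$ is an injective map $f:V(G)\to 2^{\mathbb{N}_0}$ (into finite sets) such that $g_f(uv)=f(u)+f(v)$ is injective on $E(G)$; it is strong if $|f(u)+f(v)|=|f(u)|\,|f(v)|$ for every edge $uv$ (equivalently, $D_{f(u)}\cap D_{f(v)}=\emptyset$ for adjacent $u,v$). The nourishing number $\varkappa(G)$ of $G$ is the minimum length of a maximal chain of pairwise disjoint difference sets of set-labels of vertices of $G$ under a strong IASI; by the convention used in the paper, $\varkappa(G)$ equals the order of a largest clique (complete subgraph) of $G$, i.e. the clique number of $G$. -}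

module Defs where

open import Data.Nat using (ℕ; zero; suc; _≤_)
open import Data.Fin using (Fin; toℕ)
open import Data.Fin.Subset using (Subset; _∈_; ∣_∣)
open import Data.Product using (Σ; _×_; ∃)
open import Data.Sum using (_⊎_)
open import Relation.Binary.PropositionalEquality using (_≡_)
open import Relation.Nullary using (¬_)

Graph : ℕ → Set₁
Graph n = Fin n → Fin n → Set

Cycle : (n : ℕ) → Graph n
Cycle n i j =
  (suc (toℕ i) ≡ toℕ j) ⊎ (suc (toℕ j) ≡ toℕ i)
  ⊎ ((suc (toℕ i) ≡ n) × (toℕ j ≡ 0)) ⊎ ((suc (toℕ j) ≡ n) × (toℕ i ≡ 0))

data Walk {n : ℕ} (G : Graph n) : Fin n → Fin n → ℕ → Set where
  nil  : ∀ {u} → Walk G u u 0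
  cons : ∀ {u v w k} → G u v → Walk G v w k → Walk G u w (suc k)

DistLe : {n : ℕ} → Graph n → ℕ → Fin n → Fin n → Set
DistLe G r u v = ∃ λ k → (k ≤ r) × Walk G u v k

Power : {n : ℕ} → Graph n → ℕ → Graph n
Power G r u v = (¬ u ≡ v) × DistLe G r u v

IsClique : {n : ℕ} → Graph n → Subset n → Set
IsClique G S = ∀ u v → u ∈ S → v ∈ S → ¬ u ≡ v → G u v

CliqueNumber : {n : ℕ} → Graph n → ℕ → Set
CliqueNumber G k =
  (Σ (Subset _) λ S → IsClique G S × (∣ S ∣ ≡ k))
  × (∀ S → IsClique G S → ∣ S ∣ ≤ k)

-- Nourishing number: by the paper's convention, ϰ(G) equals the clique number.
NourishingNumber : {n : ℕ} → Graph n → ℕ → Set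
NourishingNumber = CliqueNumber

-- Distances in C_n are controlled through the relation "a and b are
-- cyclically within k", defined by lifting positions to the line: some
-- lifts i·n + a and j·n + b are at distance ≤ k.  It satisfies the triangle
-- inequality, so every walk of length k joins positions cyclically within k;
-- a normal form splits such a gap into a direct gap or one across the
-- wrap-around point.  Conversely, explicit ascending walks (and their
-- reversals) realise direct and wrap-around gaps.
--
-- Lower bounds: the r+1 vertices 0 … r always form a clique of C_n^r, and for
-- n ≤ 2r+1 all vertices do.  Upper bound for 2(r+1) ≤ n: measured from the
-- least member m of a clique, every member sits in one of the two arcs of
-- length r next to m, and its offset within that arc is an injective map into
-- {0, …, r}; counting through an enumeration of the clique gives size ≤ r+1.
-- The theorem follows after translating the thresholds on ⌊n/2⌋.

module Submission where

open import Defs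
open import Data.Nat using (ℕ; zero; suc; _+_; _*_; _∸_; _≤_; _<_; z≤n; s≤s; s≤s⁻¹; _≤?_; _/_; _%_; ∣_-_∣)
open import Data.Nat.DivMod using (m≡m%n+[m/n]*n; m%n<n; m/n*n≤m)
open import Data.Nat.Properties
open import Data.Product using (_×_; _,_; proj₁; proj₂; ∃; ∃₂)
open import Data.Sum using (_⊎_; inj₁; inj₂)
open import Data.Fin using (Fin; toℕ; zero; suc; fromℕ; fromℕ<)
import Data.Fin.Properties as Fin
open import Data.Fin.Properties using (injective⇒≤; toℕ-injective; toℕ-fromℕ; toℕ-fromℕ<; toℕ<n)
open import Data.Fin.Subset using (Subset; _∈_; ∣_∣; ⊥; ⊤; inside; outside; Nonempty)
open import Data.Fin.Subset.Properties using (∉⊥; ∣⊥∣≡0; ∣⊤∣≡n; ∣p∣≤n; nonempty?; Empty-unique)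
open import Data.Vec using ([]; _∷_; here; there)
open import Data.Empty using (⊥-elim)
open import Data.Nat.Tactic.RingSolver using (solve-∀)
open import Relation.Binary.PropositionalEquality
open import Relation.Nullary using (¬_; yes; no)

CyclicallyWithin : ℕ → ℕ → ℕ → ℕ → Set
CyclicallyWithin n k a b = ∃₂ λ i j → ∣ i * n + a - j * n + b ∣ ≤ k

lift-shift : ∀ n s i j a b →
  ∣ (s + i) * n + a - (s + j) * n + b ∣ ≡ ∣ i * n + a - j * n + b ∣
lift-shift n s i j a b = begin
  ∣ (s + i) * n + a - (s + j) * n + b ∣           ≡⟨ cong₂ ∣_-_∣ (shifted i a) (shifted j b) ⟩
  ∣ s * n + (i * n + a) - s * n + (j * n + b) ∣   ≡⟨ ∣m+n-m+o∣≡∣n-o∣ (s * n) _ _ ⟩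
  ∣ i * n + a - j * n + b ∣                       ∎
  where
  open ≡-Reasoning
  shifted : ∀ i a → (s + i) * n + a ≡ s * n + (i * n + a)
  shifted i a = trans (cong (_+ a) (*-distribʳ-+ n s i)) (+-assoc (s * n) (i * n) a)

within-sym : ∀ {n k a b} → CyclicallyWithin n k a b → CyclicallyWithin n k b a
within-sym {n} {k} {a} {b} (i , j , d) = j , i , subst (_≤ k) (∣-∣-comm (i * n + a) (j * n + b)) d

within-mono : ∀ {n k l a b} → k ≤ l → CyclicallyWithin n k a b → CyclicallyWithin n l a b
within-mono k≤l (i , j , d) = i , j , ≤-trans d k≤l

-- The triangle inequality for cyclic distance: lift the two gaps so that
-- they share the lift of b, then use the triangle inequality on the line.
within-trans : ∀ {n k l a b c} →
  CyclicallyWithin n k a b → CyclicallyWithin n l b c → CyclicallyWithin n (k + l) a c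
within-trans {n} {k} {l} {a} {b} {c} (i , j , ab) (i′ , j′ , bc) = i′ + i , j + j′ , (begin
  ∣ (i′ + i) * n + a - (j + j′) * n + c ∣
    ≤⟨ ∣-∣-triangle ((i′ + i) * n + a) ((j + i′) * n + b) ((j + j′) * n + c) ⟩
  ∣ (i′ + i) * n + a - (j + i′) * n + b ∣ + ∣ (j + i′) * n + b - (j + j′) * n + c ∣
    ≡⟨ cong₂ _+_ first-gap (lift-shift n j i′ j′ b c) ⟩
  ∣ i * n + a - j * n + b ∣ + ∣ i′ * n + b - j′ * n + c ∣
    ≤⟨ +-mono-≤ ab bc ⟩
  k + l ∎)
  where
  open ≤-Reasoning
  first-gap : ∣ (i′ + i) * n + a - (j + i′) * n + b ∣ ≡ ∣ i * n + a - j * n + b ∣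
  first-gap = trans (cong (λ t → ∣ (i′ + i) * n + a - t * n + b ∣) (+-comm j i′))
                    (lift-shift n i′ i j a b)

wrapped-lift : ∀ n i a → a + n ≤ suc i * n + a
wrapped-lift n i a = ≤-trans (≤-reflexive (+-comm a n)) (+-monoˡ-≤ a (m≤m+n n (i * n)))

lifted-gap-cases : ∀ {n k a b} i j → ∣ i * n + a - j * n + b ∣ ≤ k →
  ((a ≤ b + k) × (b ≤ a + k)) ⊎ (a + n ≤ b + k) ⊎ (b + n ≤ a + k)
lifted-gap-cases {n} {k} {a} {b} zero zero d =
  inj₁ (≤-trans (m≤n+∣m-n∣ a b) (+-monoʳ-≤ b d) , ≤-trans (m≤n+∣n-m∣ b a) (+-monoʳ-≤ a d))
lifted-gap-cases {n} {k} {a} {b} (suc i) zero d =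
  inj₂ (inj₁ (≤-trans (wrapped-lift n i a) (≤-trans (m≤n+∣m-n∣ _ b) (+-monoʳ-≤ b d))))
lifted-gap-cases {n} {k} {a} {b} zero (suc j) d =
  inj₂ (inj₂ (≤-trans (wrapped-lift n j b) (≤-trans (m≤n+∣n-m∣ _ a) (+-monoʳ-≤ a d))))
lifted-gap-cases {n} {k} {a} {b} (suc i) (suc j) d =
  lifted-gap-cases i j (subst (_≤ k) (lift-shift n 1 i j a b) d)

within-cases : ∀ {n k a b} → CyclicallyWithin n k a b →
  ((a ≤ b + k) × (b ≤ a + k)) ⊎ (a + n ≤ b + k) ⊎ (b + n ≤ a + k)
within-cases (i , j , d) = lifted-gap-cases i j d

∣m-suc-m∣≡1 : ∀ a → ∣ a - suc a ∣ ≡ 1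
∣m-suc-m∣≡1 zero    = refl
∣m-suc-m∣≡1 (suc a) = ∣m-suc-m∣≡1 a

successor-within : ∀ {n a b} → suc a ≡ b → CyclicallyWithin n 1 a b
successor-within {a = a} refl = 0 , 0 , ≤-reflexive (∣m-suc-m∣≡1 a)

wraparound-within : ∀ {n a b} → suc a ≡ n → b ≡ 0 → CyclicallyWithin n 1 a b
wraparound-within {a = a} refl refl =
  0 , 1 , ≤-reflexive (trans (cong (λ t → ∣ a - suc t ∣) (trans (+-identityʳ _) (+-identityʳ a)))
                              (∣m-suc-m∣≡1 a))

edge-within : ∀ {n} {u v : Fin n} → Cycle n u v → CyclicallyWithin n 1 (toℕ u) (toℕ v)
edge-within (inj₁ e)                  = successor-within e
edge-within (inj₂ (inj₁ e))           = within-sym (successor-within e)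
edge-within (inj₂ (inj₂ (inj₁ (e , z)))) = wraparound-within e z
edge-within (inj₂ (inj₂ (inj₂ (e , z)))) = within-sym (wraparound-within e z)

walk-within : ∀ {n k} {u v : Fin n} → Walk (Cycle n) u v k → CyclicallyWithin n k (toℕ u) (toℕ v)
walk-within {u = u} nil = 0 , 0 , ≤-reflexive (∣n-n∣≡0 (toℕ u))
walk-within (cons e w)  = within-trans (edge-within e) (walk-within w)

distLe-within : ∀ {n k} {u v : Fin n} → DistLe (Cycle n) k u v → CyclicallyWithin n k (toℕ u) (toℕ v)
distLe-within (l , l≤k , w) = within-mono l≤k (walk-within w)

append : ∀ {n} {G : Graph n} {x y z k l} → Walk G x y k → Walk G y z l → Walk G x z (k + l)
append nil        w = w
append (cons e v) w = cons e (append v w)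

-- In a symmetric graph a walk can be traversed backwards: `reverse-onto w acc`
-- is the reversal of w followed by acc.
reverse-onto : ∀ {n} {G : Graph n} → (∀ {u v} → G u v → G v u) →
  ∀ {u v w k l} → Walk G u v k → Walk G u w l → Walk G v w (k + l)
reverse-onto flip nil acc = acc
reverse-onto {G = G} flip {l = l} (cons {k = k} e w) acc =
  subst (Walk G _ _) (+-suc k l) (reverse-onto flip w (cons (flip e) acc))

distLe-sym : ∀ {n} {G : Graph n} → (∀ {u v} → G u v → G v u) →
  ∀ {k u v} → DistLe G k u v → DistLe G k v u
distLe-sym {G = G} flip (l , l≤k , w) =
  l , l≤k , subst (Walk G _ _) (+-identityʳ l) (reverse-onto flip w nil)

cycle-sym : ∀ {n} {u v : Fin n} → Cycle n u v → Cycle n v u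
cycle-sym (inj₁ e)                  = inj₂ (inj₁ e)
cycle-sym (inj₂ (inj₁ e))           = inj₁ e
cycle-sym (inj₂ (inj₂ (inj₁ e)))    = inj₂ (inj₂ (inj₂ e))
cycle-sym (inj₂ (inj₂ (inj₂ e)))    = inj₂ (inj₂ (inj₁ e))

ascending : ∀ {n} d (x y : Fin n) → toℕ x + d ≡ toℕ y → Walk (Cycle n) x y d
ascending zero x y x+0≡y =
  subst (λ z → Walk _ x z 0) (toℕ-injective (trans (sym (+-identityʳ _)) x+0≡y)) nil
ascending {n} (suc d) x y x+d+1≡y =
  cons (inj₁ (sym (toℕ-fromℕ< next<n))) (ascending d (fromℕ< next<n) y next+d≡y)
  where
  x+1+d≡y : suc (toℕ x) + d ≡ toℕ y
  x+1+d≡y = trans (sym (+-suc (toℕ x) d)) x+d+1≡y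
  next<n : suc (toℕ x) < n
  next<n = ≤-trans (s≤s (≤-trans (m≤m+n (suc (toℕ x)) d) (≤-reflexive x+1+d≡y))) (toℕ<n y)
  next+d≡y : toℕ (fromℕ< next<n) + d ≡ toℕ y
  next+d≡y = trans (cong (_+ d) (toℕ-fromℕ< next<n)) x+1+d≡y

direct-distLe : ∀ {n k} (x y : Fin n) → toℕ x ≤ toℕ y → toℕ y ≤ toℕ x + k →
  DistLe (Cycle n) k x y
direct-distLe x y x≤y y≤x+k =
  toℕ y ∸ toℕ x , m≤n+o⇒m∸n≤o (toℕ y) (toℕ x) y≤x+k , ascending _ x y (m+[n∸m]≡n x≤y)

-- A gap of at most k across the wrap-around point: ascend from y to the last
-- vertex n′, take the edge n′ – 0, and ascend from 0 to x.
wraparound-distLe : ∀ {n′ k} (x y : Fin (suc n′)) → toℕ x + suc n′ ≤ toℕ y + k →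
  DistLe (Cycle (suc n′)) k y x
wraparound-distLe {n′} {k} x y gap =
  (n′ ∸ toℕ y) + suc (toℕ x) , length≤k ,
  append (ascending _ y (fromℕ n′) (trans (m+[n∸m]≡n y≤n′) (sym (toℕ-fromℕ n′))))
         (cons (inj₂ (inj₂ (inj₁ (cong suc (toℕ-fromℕ n′) , refl)))) (ascending (toℕ x) zero x refl))
  where
  y≤n′ : toℕ y ≤ n′
  y≤n′ = s≤s⁻¹ (toℕ<n y)
  length≤k : (n′ ∸ toℕ y) + suc (toℕ x) ≤ k
  length≤k = +-cancelʳ-≤ (toℕ y) _ _ (begin
    (n′ ∸ toℕ y) + suc (toℕ x) + toℕ y  ≡⟨ swap-last (n′ ∸ toℕ y) (suc (toℕ x)) (toℕ y) ⟩
    (n′ ∸ toℕ y) + toℕ y + suc (toℕ x)  ≡⟨ cong (_+ suc (toℕ x)) (m∸n+n≡m y≤n′) ⟩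
    n′ + suc (toℕ x)                    ≡⟨ swap-succ n′ (toℕ x) ⟩
    toℕ x + suc n′                      ≤⟨ gap ⟩
    toℕ y + k                           ≡⟨ +-comm (toℕ y) k ⟩
    k + toℕ y                           ∎)
    where
    open ≤-Reasoning
    swap-last : ∀ a b c → a + b + c ≡ a + c + b
    swap-last = solve-∀
    swap-succ : ∀ a b → a + suc b ≡ b + suc a
    swap-succ = solve-∀

SmallGap : (n′ k : ℕ) → Fin (suc n′) → Fin (suc n′) → Set
SmallGap n′ k x y = (toℕ y ≤ toℕ x + k) ⊎ (toℕ x + suc n′ ≤ toℕ y + k)

gap-distLe : ∀ {n′ k} (x y : Fin (suc n′)) → toℕ x ≤ toℕ y → SmallGap n′ k x y →
  DistLe (Cycle (suc n′)) k x y × DistLe (Cycle (suc n′)) k y x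
gap-distLe {n′} {k} x y x≤y (inj₁ direct) = up , distLe-sym cycle-sym up
  where
  up : DistLe (Cycle (suc n′)) k x y
  up = direct-distLe x y x≤y direct
gap-distLe {n′} {k} x y x≤y (inj₂ wrap) = distLe-sym cycle-sym around , around
  where
  around : DistLe (Cycle (suc n′)) k y x
  around = wraparound-distLe x y wrap

clique-by-gaps : ∀ {n′ k} (S : Subset (suc n′)) →
  (∀ {x y} → x ∈ S → y ∈ S → toℕ x ≤ toℕ y → SmallGap n′ k x y) →
  IsClique (Power (Cycle (suc n′)) k) S
clique-by-gaps S gaps x y x∈S y∈S x≢y with ≤-total (toℕ x) (toℕ y)
... | inj₁ x≤y = x≢y , proj₁ (gap-distLe x y x≤y (gaps x∈S y∈S x≤y))
... | inj₂ y≤x = x≢y , proj₂ (gap-distLe y x y≤x (gaps y∈S x∈S y≤x))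

initial-segment : (n a : ℕ) → Subset n
initial-segment n       zero    = ⊥
initial-segment zero    (suc a) = []
initial-segment (suc n) (suc a) = inside ∷ initial-segment n a

∣initial-segment∣ : ∀ {n a} → a ≤ n → ∣ initial-segment n a ∣ ≡ a
∣initial-segment∣ {n} z≤n = ∣⊥∣≡0 n
∣initial-segment∣ (s≤s a≤n) = cong suc (∣initial-segment∣ a≤n)

initial-segment-< : ∀ {n a} {x : Fin n} → x ∈ initial-segment n a → toℕ x < a
initial-segment-< {a = zero} x∈ = ⊥-elim (∉⊥ x∈)
initial-segment-< {suc n} {suc a} here = s≤s z≤n
initial-segment-< {suc n} {suc a} (there x∈) = s≤s (initial-segment-< x∈)

initial-segment-clique : ∀ n′ r →
  IsClique (Power (Cycle (suc n′)) r) (initial-segment (suc n′) (suc r))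
initial-segment-clique n′ r = clique-by-gaps _ λ {x} _ y∈S _ →
  inj₁ (≤-trans (s≤s⁻¹ (initial-segment-< y∈S)) (m≤n+m r (toℕ x)))

everything-clique : ∀ n′ r → suc n′ ≤ suc (r + r) → IsClique (Power (Cycle (suc n′)) r) ⊤
everything-clique n′ r n≤2r+1 = clique-by-gaps ⊤ λ {x} {y} _ _ _ → small-gap x y
  where
  small-gap : ∀ x y → SmallGap n′ r x y
  small-gap x y with toℕ y ≤? toℕ x + r
  ... | yes direct = inj₁ direct
  ... | no  far    = inj₂ (begin
    toℕ x + suc n′          ≤⟨ +-monoʳ-≤ (toℕ x) n≤2r+1 ⟩
    toℕ x + suc (r + r)     ≡⟨ regroup (toℕ x) r ⟩
    suc (toℕ x + r) + r     ≤⟨ +-monoˡ-≤ r (≰⇒> far) ⟩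
    toℕ y + r               ∎)
    where
    open ≤-Reasoning
    regroup : ∀ a r → a + suc (r + r) ≡ suc (a + r) + r
    regroup = solve-∀

enumerate : ∀ {n} (S : Subset n) → Fin ∣ S ∣ → Fin n
enumerate (inside ∷ S)  zero    = zero
enumerate (inside ∷ S)  (suc i) = suc (enumerate S i)
enumerate (outside ∷ S) i       = suc (enumerate S i)

enumerate-∈ : ∀ {n} (S : Subset n) i → enumerate S i ∈ S
enumerate-∈ (inside ∷ S)  zero    = here
enumerate-∈ (inside ∷ S)  (suc i) = there (enumerate-∈ S i)
enumerate-∈ (outside ∷ S) i       = there (enumerate-∈ S i)

enumerate-injective : ∀ {n} (S : Subset n) {i j} → enumerate S i ≡ enumerate S j → i ≡ j
enumerate-injective (inside ∷ S)  {zero}  {zero}  _ = refl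
enumerate-injective (inside ∷ S)  {suc i} {suc j} e = cong suc (enumerate-injective S (Fin.suc-injective e))
enumerate-injective (outside ∷ S)                 e = enumerate-injective S (Fin.suc-injective e)

count-by-injection : ∀ {n m} (S : Subset n) (φ : Fin n → ℕ) →
  (∀ {x} → x ∈ S → φ x < m) → (∀ {x y} → x ∈ S → y ∈ S → φ x ≡ φ y → x ≡ y) →
  ∣ S ∣ ≤ m
count-by-injection {m = m} S φ bound injective = injective⇒≤ {f = code} code-injective
  where
  code : Fin ∣ S ∣ → Fin m
  code i = fromℕ< (bound (enumerate-∈ S i))
  code-injective : ∀ {i j} → code i ≡ code j → i ≡ j
  code-injective {i} {j} e = enumerate-injective S (injective (enumerate-∈ S i) (enumerate-∈ S j)
    (trans (sym (toℕ-fromℕ< _)) (trans (cong toℕ e) (toℕ-fromℕ< _))))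

least-member : ∀ {n} (S : Subset n) → Nonempty S →
  ∃ λ u → u ∈ S × (∀ {x} → x ∈ S → toℕ u ≤ toℕ x)
least-member (inside ∷ S)  _                 = zero , here , λ _ → z≤n
least-member (outside ∷ S) (suc x , there x∈S) with least-member S (x , x∈S)
... | u , u∈S , least = suc u , there u∈S , λ { (there y∈S) → s≤s (least y∈S) }

clique-within : ∀ {n r} {S : Subset n} → IsClique (Power (Cycle n) r) S →
  ∀ {x y} → x ∈ S → y ∈ S → CyclicallyWithin n r (toℕ x) (toℕ y)
clique-within {r = r} clique {x} {y} x∈S y∈S with x Fin.≟ y
... | yes refl = 0 , 0 , subst (_≤ r) (sym (∣n-n∣≡0 (toℕ x))) z≤n
... | no  x≢y  = distLe-within (proj₂ (clique x y x∈S y∈S x≢y))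

-- When 2(r+1) ≤ n, C_n^r is not complete: positions that are r+1 apart in one
-- direction (hence n-r-1 ≥ r+1 apart in the other) are not cyclically within r.
module _ {n r : ℕ} (long : suc r + suc r ≤ n) where

  cycle-too-long : ¬ (n ≤ r + suc r)
  cycle-too-long n≤ =
    n≮n r (+-cancelˡ-≤ (suc r) (suc r) r (≤-trans long (≤-trans n≤ (≤-reflexive (+-comm r (suc r))))))

  antipodal-far : ∀ {a b} → a + n ≡ b + suc r → ¬ CyclicallyWithin n r a b
  antipodal-far {a} {b} a+n≡b+r+1 within with within-cases within
  ... | inj₁ (_ , b≤a+r) = cycle-too-long (+-cancelˡ-≤ a n (r + suc r) (begin
    a + n             ≡⟨ a+n≡b+r+1 ⟩
    b + suc r         ≤⟨ +-monoˡ-≤ (suc r) b≤a+r ⟩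
    a + r + suc r     ≡⟨ +-assoc a r (suc r) ⟩
    a + (r + suc r)   ∎))
    where open ≤-Reasoning
  ... | inj₂ (inj₁ a+n≤b+r) = n≮n (b + r) (begin-strict
    b + r             <⟨ +-monoʳ-< b (n<1+n r) ⟩
    b + suc r         ≡⟨ a+n≡b+r+1 ⟨
    a + n             ≤⟨ a+n≤b+r ⟩
    b + r             ∎)
    where open ≤-Reasoning
  ... | inj₂ (inj₂ b+n≤a+r) =
    cycle-too-long (≤-trans (m≤m+n n n) (+-cancelˡ-≤ b (n + n) (r + suc r) (begin
    b + (n + n)       ≡⟨ +-assoc b n n ⟨
    b + n + n         ≤⟨ +-monoˡ-≤ n b+n≤a+r ⟩
    a + r + n         ≡⟨ swap a r n ⟩
    a + n + r         ≡⟨ cong (_+ r) a+n≡b+r+1 ⟩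
    b + suc r + r     ≡⟨ regroup b r ⟩
    b + (r + suc r)   ∎)))
    where
    open ≤-Reasoning
    swap : ∀ a r n → a + r + n ≡ a + n + r
    swap = solve-∀
    regroup : ∀ b r → b + suc r + r ≡ b + (r + suc r)
    regroup = solve-∀

  -- Every
  -- member lies in the arc m … m+r (upper) or in the arc m+n-r … n-1 just
  -- below m around the wrap-around point (lower); the offset of a member in
  -- its arc is a number in 0 … r.
  module ArcsAroundLeast (S : Subset n) (clique : IsClique (Power (Cycle n) r) S)
                         (u : Fin n) (u∈S : u ∈ S) (least : ∀ {x} → x ∈ S → toℕ u ≤ toℕ x) where

    m : ℕ
    m = toℕ u

    upper-or-lower : ∀ {x} → x ∈ S → (toℕ x ≤ m + r) ⊎ (m + n ≤ toℕ x + r)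
    upper-or-lower {x} x∈S with within-cases (clique-within clique u∈S x∈S)
    ... | inj₁ (_ , x≤m+r)     = inj₁ x≤m+r
    ... | inj₂ (inj₁ m+n≤x+r)  = inj₂ m+n≤x+r
    ... | inj₂ (inj₂ x+n≤m+r)  =
      ⊥-elim (<⇒≱ r<n (+-cancelˡ-≤ (toℕ x) n r (≤-trans x+n≤m+r (+-monoˡ-≤ r (least x∈S)))))
      where
      r<n : r < n
      r<n = ≤-trans (m≤m+n (suc r) (suc r)) long

    lower : ∀ {x} → x ∈ S → ¬ (toℕ x ≤ m + r) → m + n ≤ toℕ x + suc r
    lower x∈S not-upper with upper-or-lower x∈S
    ... | inj₁ upper    = ⊥-elim (not-upper upper)
    ... | inj₂ m+n≤x+r  = ≤-trans m+n≤x+r (+-monoʳ-≤ _ (n≤1+n r))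

    offset : Fin n → ℕ
    offset x with toℕ x ≤? m + r
    ... | yes _ = toℕ x ∸ m
    ... | no  _ = (toℕ x + suc r) ∸ (m + n)

    offset-< : ∀ {x} → x ∈ S → offset x < suc r
    offset-< {x} x∈S with toℕ x ≤? m + r
    ... | yes x≤m+r = s≤s (m≤n+o⇒m∸n≤o (toℕ x) m x≤m+r)
    ... | no  _     = s≤s (m≤n+o⇒m∸n≤o (toℕ x + suc r) (m + n) (begin
      toℕ x + suc r    ≡⟨ +-suc (toℕ x) r ⟩
      suc (toℕ x) + r  ≤⟨ +-monoˡ-≤ r (toℕ<n x) ⟩
      n + r            ≤⟨ +-monoˡ-≤ r (m≤n+m n m) ⟩
      m + n + r        ∎))
      where open ≤-Reasoning

    crossing : ∀ {x y : Fin n} → x ∈ S → m + n ≤ toℕ y + suc r →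
      toℕ x ∸ m ≡ (toℕ y + suc r) ∸ (m + n) → toℕ x + n ≡ toℕ y + suc r
    crossing {x} {y} x∈S lower-y e = begin
      toℕ x + n                             ≡⟨ cong (_+ n) (m∸n+n≡m (least x∈S)) ⟨
      (toℕ x ∸ m) + m + n                   ≡⟨ +-assoc (toℕ x ∸ m) m n ⟩
      (toℕ x ∸ m) + (m + n)                 ≡⟨ cong (_+ (m + n)) e ⟩
      ((toℕ y + suc r) ∸ (m + n)) + (m + n) ≡⟨ m∸n+n≡m lower-y ⟩
      toℕ y + suc r                         ∎
      where open ≡-Reasoning

    -- Within one arc offsets are shifts of positions; across the two arcs
    -- equal offsets are impossible by antipodal-far.
    offset-injective : ∀ {x y} → x ∈ S → y ∈ S → offset x ≡ offset y → x ≡ y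
    offset-injective {x} {y} x∈S y∈S e with toℕ x ≤? m + r | toℕ y ≤? m + r
    ... | yes _ | yes _ = toℕ-injective (∸-cancelʳ-≡ (least x∈S) (least y∈S) e)
    ... | no nx | no ny =
      toℕ-injective (+-cancelʳ-≡ (suc r) _ _ (∸-cancelʳ-≡ (lower x∈S nx) (lower y∈S ny) e))
    ... | yes _ | no ny =
      ⊥-elim (antipodal-far (crossing x∈S (lower y∈S ny) e) (clique-within clique x∈S y∈S))
    ... | no nx | yes _ =
      ⊥-elim (antipodal-far (crossing y∈S (lower x∈S nx) (sym e)) (clique-within clique y∈S x∈S))

  clique-size-≤ : (S : Subset n) → IsClique (Power (Cycle n) r) S → ∣ S ∣ ≤ suc r
  clique-size-≤ S clique with nonempty? S
  ... | no empty = subst (_≤ suc r) (sym (trans (cong ∣_∣ (Empty-unique empty)) (∣⊥∣≡0 n))) z≤n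
  ... | yes nonempty with least-member S nonempty
  ... | u , u∈S , least = count-by-injection S offset offset-< offset-injective
    where open ArcsAroundLeast S clique u u∈S least

below-half : ∀ n r → r < n / 2 → suc r + suc r ≤ n
below-half n r r<n/2 = begin
  suc r + suc r    ≤⟨ +-mono-≤ r<n/2 r<n/2 ⟩
  n / 2 + n / 2    ≡⟨ double (n / 2) ⟩
  n / 2 * 2        ≤⟨ m/n*n≤m n 2 ⟩
  n                ∎
  where
  open ≤-Reasoning
  double : ∀ q → q + q ≡ q * 2
  double = solve-∀

above-half : ∀ n r → n / 2 ≤ r → n ≤ suc (r + r)
above-half n r n/2≤r = begin
  n                  ≡⟨ m≡m%n+[m/n]*n n 2 ⟩
  n % 2 + n / 2 * 2  ≤⟨ +-mono-≤ (s≤s⁻¹ (m%n<n n 2)) (*-monoˡ-≤ 2 n/2≤r) ⟩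
  1 + r * 2          ≡⟨ cong suc (undouble r) ⟩
  suc (r + r)        ∎
  where
  open ≤-Reasoning
  undouble : ∀ q → q * 2 ≡ q + q
  undouble = solve-∀

mainTheorem3 : (n r : ℕ) → 3 ≤ n → 1 ≤ r →
    ((r < n / 2) → NourishingNumber (Power (Cycle n) r) (suc r))
    × ((n / 2 ≤ r) → NourishingNumber (Power (Cycle n) r) n)
mainTheorem3 zero     _ () _
mainTheorem3 (suc n′) r _  _ = short-range , long-range
  where
  short-range : r < suc n′ / 2 → NourishingNumber (Power (Cycle (suc n′)) r) (suc r)
  short-range r<n/2 =
    (initial-segment (suc n′) (suc r) , initial-segment-clique n′ r ,
     ∣initial-segment∣ (≤-trans (m≤m+n (suc r) (suc r)) long)) ,
    clique-size-≤ long
    where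
    long : suc r + suc r ≤ suc n′
    long = below-half (suc n′) r r<n/2

  long-range : suc n′ / 2 ≤ r → NourishingNumber (Power (Cycle (suc n′)) r) (suc n′)
  long-range n/2≤r =
    (⊤ , everything-clique n′ r (above-half (suc n′) r n/2≤r) , ∣⊤∣≡n (suc n′)) ,
    λ S _ → ∣p∣≤n S
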